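{- Let $\mathcal E$ be an exchangeability system for a noncommutative probability space $(\mathcal A,\phi)$, let $n\ge 1$ and $X_1,\dots,X_n\in\mathcal A$. Suppose there is a subset $I\subseteq[n]$ with $I\neq\emptyset$ and $I\neq[n]$ such that the families $(X_j)_{j\in I}$ and $(X_j)_{j\in[n]\setminus I}$ are $\mathcal E$-independent. Then $K_n(X_1,\dots,X_n)=0$.
   Context: A noncommutative probability space is a pair $(\mathcal A,\phi)$ of a complex unital algebra $\mathcal A$ and a unital linear functional $\phi$. An exchangeability system $\mathcal E$ for $(\mathcal A,\phi)$ consists of a noncommutative probability space $(\mathcal U,\tilde\phi)$ and embeddings (injective unital homomorphisms) $\iota_k:\mathcal A\to\mathcal U$, $k\in\mathbb N$, with $\tilde\phi\circ\iota_k=\phi$; write $X^{(k)}=\iota_k(X)$. It is required that for all $n$, all $X_1,\dots,X_n\in\mathcal A$, all indices $i_1,\dots,i_n\in\mathbb N$ and every permutation $\sigma$ of $\mathbb N$: $\tilde\phi(X_1^{(i_1)}\cdots X_n^{(i_n)})=\tilde\phi(X_1^{(\sigma(i_1))}\cdots X_n^{(\sigma(i_n))})$. Thus this value depends only on the kernel of $j\mapsto i_j$ (the partition of $[n]=\{1,\dots,n\}$ into level sets of this map); for a set partition $\pi$ of $[n]$ the common value is denoted $\phi_\pi(X_1,\dots,X_n)$. Two subalgebras $\mathcal B,\mathcal C\subseteq\mathcal A$ are $\mathcal E$-independent if for all $X_1,\dots,X_n\in\mathcal B\cup\mathcal C$ and all disjoint $I,J$ with $I\cup J=[n]$, $X_i\in\mathcal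 B$ for $i\in I$, $X_i\in\mathcal C$ for $i\in J$, one has $\phi_\pi(X_1,\dots,X_n)=\phi_{\pi'}(X_1,\dots,X_n)$ whenever the partitions $\pi,\pi'$ of $[n]$ satisfy $\pi|_I=\pi'|_I$ and $\pi|_J=\pi'|_J$. Two families of elements are $\mathcal E$-independent if the subalgebras they generate are. The $n$-th cumulant is $K_n(X_1,\dots,X_n)=\frac1n\tilde\phi(X_1^\omega X_2^\omega\cdots X_n^\omega)$, where $\omega$ is a primitive $n$-th root of unity and $X_j^\omega=\sum_{k=1}^n\omega^kX_j^{(k)}$. -}

module Defs where

open import Level using (0ℓ)
open import Data.Nat as ℕ using (ℕ; zero; suc)
open import Data.Fin using (Fin; toℕ)
import Data.Fin as Fin
open import Data.Fin.Subset using (Subset; _∈_; _∉_; ∁)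
open import Data.Product using (_×_; Σ; ∃)
open import Function using (_∘_; _⇔_)
open import Function.Bundles using (_↔_; Inverse)
open import Relation.Nullary using (¬_)
open import Relation.Binary.PropositionalEquality using (_≡_)
open import Algebra.Bundles using (CommutativeRing; Ring)

-- Scalars: a field of characteristic zero (stand-in for ℂ)

ringOfℕ : (R : CommutativeRing 0ℓ 0ℓ) → ℕ → CommutativeRing.Carrier R
ringOfℕ R zero = CommutativeRing.0# R
ringOfℕ R (suc m) = CommutativeRing._+_ R (CommutativeRing.1# R) (ringOfℕ R m)

record CharZeroField : Set₁ where
  field
    scalarRing : CommutativeRing 0ℓ 0ℓ
  open CommutativeRing scalarRing public hiding (ring)
  field
    _⁻¹[_] : (x : Carrier) → ¬ (x ≈ 0#) → Carrier
    ⁻¹-inverse : ∀ x (p : ¬ (x ≈ 0#)) → x * (x ⁻¹[ p ]) ≈ 1#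
    charZero : ∀ m → ¬ (ringOfℕ scalarRing (suc m) ≈ 0#)

  pow : Carrier → ℕ → Carrier
  pow x zero = 1#
  pow x (suc k) = x * pow x k

  PrimitiveRoot : ℕ → Carrier → Set
  PrimitiveRoot n ω = pow ω n ≈ 1# × (∀ k → 0 ℕ.< k → k ℕ.< n → ¬ (pow ω k ≈ 1#))

record UnitalAlgebra (K : CharZeroField) : Set₁ where
  module K = CharZeroField K
  field
    algRing : Ring 0ℓ 0ℓ
  open Ring algRing public
  field
    _·_ : K.Carrier → Carrier → Carrier
    ·-cong : ∀ {a b x y} → a K.≈ b → x ≈ y → (a · x) ≈ (b · y)
    ·-distribˡ : ∀ a x y → (a · (x + y)) ≈ ((a · x) + (a · y))
    ·-distribʳ : ∀ a b x → ((a K.+ b) · x) ≈ ((a · x) + (b · x))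
    ·-assoc : ∀ a b x → ((a K.* b) · x) ≈ (a · (b · x))
    ·-identity : ∀ x → (K.1# · x) ≈ x
    ·-*-assocˡ : ∀ a x y → ((a · x) * y) ≈ (a · (x * y))
    ·-*-assocʳ : ∀ a x y → (x * (a · y)) ≈ (a · (x * y))

  prod : ∀ {m} → (Fin m → Carrier) → Carrier
  prod {zero} f = 1#
  prod {suc m} f = f Fin.zero * prod (f ∘ Fin.suc)

  sum : ∀ {m} → (Fin m → Carrier) → Carrier
  sum {zero} f = 0#
  sum {suc m} f = f Fin.zero + sum (f ∘ Fin.suc)

  data Gen {ι : Set} (x : ι → Carrier) : Carrier → Set where
    gen  : ∀ i → Gen x (x i)
    one  : Gen x 1#
    zer  : Gen x 0#
    add  : ∀ {a b} → Gen x a → Gen x b → Gen x (a + b)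
    mul  : ∀ {a b} → Gen x a → Gen x b → Gen x (a * b)
    smul : ∀ c {a} → Gen x a → Gen x (c · a)
    resp : ∀ {a b} → a ≈ b → Gen x a → Gen x b

record NCProbabilitySpace (K : CharZeroField) : Set₁ where
  field
    alg : UnitalAlgebra K
  open UnitalAlgebra alg public
  field
    φ : Carrier → K.Carrier
    φ-cong : ∀ {x y} → x ≈ y → φ x K.≈ φ y
    φ-+ : ∀ x y → φ (x + y) K.≈ (φ x K.+ φ y)
    φ-· : ∀ a x → φ (a · x) K.≈ (a K.* φ x)
    φ-unit : φ 1# K.≈ K.1#

record Embedding {K : CharZeroField} (A B : UnitalAlgebra K) : Set where
  private
    module A = UnitalAlgebra A
    module B = UnitalAlgebra B
  field
    map : A.Carrier → B.Carrier
    cong : ∀ {x y} → x A.≈ y → map x B.≈ map y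
    injective : ∀ {x y} → map x B.≈ map y → x A.≈ y
    hom-+ : ∀ x y → map (x A.+ y) B.≈ (map x B.+ map y)
    hom-* : ∀ x y → map (x A.* y) B.≈ (map x B.* map y)
    hom-· : ∀ a x → map (a A.· x) B.≈ (a B.· map x)
    hom-1 : map A.1# B.≈ B.1#

record ExchangeabilitySystem {K : CharZeroField} (𝒜 : NCProbabilitySpace K) : Set₁ where
  private
    module 𝒜 = NCProbabilitySpace 𝒜
    module K = CharZeroField K
  field
    𝒰 : NCProbabilitySpace K
  module 𝒰 = NCProbabilitySpace 𝒰
  field
    ι : ℕ → Embedding 𝒜.alg 𝒰.alg
    ι-state : ∀ k X → 𝒰.φ (Embedding.map (ι k) X) K.≈ 𝒜.φ X

  copy : ℕ → 𝒜.Carrier → 𝒰.Carrier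
  copy k = Embedding.map (ι k)

  mixedMoment : ∀ {m} → (Fin m → 𝒜.Carrier) → (Fin m → ℕ) → K.Carrier
  mixedMoment X i = 𝒰.φ (𝒰.prod (λ j → copy (i j) (X j)))

  field
    exchangeable : ∀ m (X : Fin m → 𝒜.Carrier) (i : Fin m → ℕ) (σ : ℕ ↔ ℕ) →
      mixedMoment X i K.≈ mixedMoment X (Inverse.to σ ∘ i)

-- Partitions of [m] are represented as kernels of index maps i : Fin m → ℕ
-- (every partition arises so); φ_π(X) = mixedMoment X i for any i with
-- ker i = π.  Two index maps induce the same restricted partition on S ⊆ [m]:

SameKernelOn : ∀ {m} → Subset m → (Fin m → ℕ) → (Fin m → ℕ) → Set
SameKernelOn S i i′ = ∀ j k → j ∈ S → k ∈ S → (i j ≡ i k ⇔ i′ j ≡ i′ k)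

Independent : ∀ {K} {𝒜 : NCProbabilitySpace K} → ExchangeabilitySystem 𝒜 →
              (NCProbabilitySpace.Carrier 𝒜 → Set) →
              (NCProbabilitySpace.Carrier 𝒜 → Set) → Set
Independent {K} {𝒜} ℰ B C =
  ∀ m (X : Fin m → NCProbabilitySpace.Carrier 𝒜) (I : Subset m) →
  (∀ j → j ∈ I → B (X j)) → (∀ j → j ∉ I → C (X j)) →
  ∀ (i i′ : Fin m → ℕ) → SameKernelOn I i i′ → SameKernelOn (∁ I) i i′ →
  CharZeroField._≈_ K (ExchangeabilitySystem.mixedMoment ℰ X i)
                      (ExchangeabilitySystem.mixedMoment ℰ X i′)

IndependentFamilies : ∀ {K} {𝒜 : NCProbabilitySpace K} → ExchangeabilitySystem 𝒜 →
  ∀ {n} → (Fin n → NCProbabilitySpace.Carrier 𝒜) → Subset n → Set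
IndependentFamilies {K} {𝒜} ℰ {n} X I =
  Independent ℰ
    (UnitalAlgebra.Gen (NCProbabilitySpace.alg 𝒜) {Σ (Fin n) (λ j → j ∈ I)} (λ p → X (Data.Product.proj₁ p)))
    (UnitalAlgebra.Gen (NCProbabilitySpace.alg 𝒜) {Σ (Fin n) (λ j → j ∉ I)} (λ p → X (Data.Product.proj₁ p)))

module _ {K : CharZeroField} {𝒜 : NCProbabilitySpace K} (ℰ : ExchangeabilitySystem 𝒜) where
  private
    module K = CharZeroField K
    module 𝒜 = NCProbabilitySpace 𝒜
    module ℰ = ExchangeabilitySystem ℰ

  -- X^ω for the n-th cumulant (k ranges over 1..n)
  ωCopy : (n : ℕ) → K.Carrier → 𝒜.Carrier → ℰ.𝒰.Carrier
  ωCopy n ω X = ℰ.𝒰.sum {n} (λ k → K.pow ω (suc (toℕ k)) ℰ.𝒰.· ℰ.copy (suc (toℕ k)) X)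

  cumulant : (m : ℕ) → K.Carrier → (Fin (suc m) → 𝒜.Carrier) → K.Carrier
  cumulant m ω X =
    ((ringOfℕ K.scalarRing (suc m)) K.⁻¹[ K.charZero m ]) K.*
      ℰ.𝒰.φ (ℰ.𝒰.prod (λ j → ωCopy (suc m) ω (X j)))

-- Expanding every X_j^ω = Σ_k ω^k X_j^{(k)} writes φ̃(X_1^ω ⋯ X_n^ω) as a sum
-- S over all κ : [n] → [n] of ω^{Σ_j κ(j)} φ̃(X_1^{(κ 1)} ⋯ X_n^{(κ n)}).
-- Lowering κ(j) cyclically by one for the j ∈ I permutes the terms of S; it
-- preserves the kernel of κ on I and on its complement, so by ℰ-independence
-- each mixed moment is unchanged, while (as ω^n = 1) each weight is divided
-- by ω^{|I|}.  Thus S = ω^{|I|} S, and since 0 < |I| < n and ω is primitive,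
-- S = 0.

module Submission where

open import Defs
open import Data.Nat using (ℕ; suc)
open import Data.Fin using (Fin)
open import Data.Fin.Subset using (Subset; Nonempty; ∁)

open import Level using (_⊔_)
open import Data.Nat using (zero; _<_)
import Data.Nat.Properties as ℕₚ
open import Data.Bool using (true; false; if_then_else_; not)
open import Data.Bool.Properties using (not-injective)
open import Data.Fin as Fin using (toℕ; fromℕ; inject₁)
import Data.Fin.Properties as Finₚ
open import Data.Fin.Subset using (_∈_; ∣_∣; inside; outside)
open import Data.Fin.Subset.Properties
  using (p⊂q⇒∣p∣<∣q∣; ⊥⊆; ∉⊥; ⊆⊤; ∈⊤; ∣⊥∣≡0; ∣⊤∣≡n; x∈∁p⇒x∉p)
open import Data.Vec using ([]; _∷_; lookup)
open import Data.Vec.Properties using ([]=⇒lookup; lookup-map)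
open import Data.Vec.Functional using () renaming (_∷_ to _◂_)
open import Data.Vec.Functional.Properties using (∷-cong)
open import Data.Product using (_,_)
open import Function using (_∘_; id; mk⇔)
open import Function.Definitions using (Injective)
open import Relation.Nullary using (¬_; contradiction)
open import Relation.Binary.Core using (_Preserves_⟶_)
open import Relation.Binary.PropositionalEquality as ≡ using (_≡_; _≗_)
open import Algebra.Bundles using (Monoid; CommutativeMonoid; Semiring; CommutativeRing)
import Algebra.Properties.Ring as RingProperties
import Algebra.Properties.Monoid.Sum as MonoidSum
import Algebra.Properties.Semiring.Sum as SemiringSum
import Algebra.Properties.CommutativeMonoid.Sum as CommutativeMonoidSum
import Relation.Binary.Reasoning.Setoid as SetoidReasoning

cyclicPred : ∀ {m} → Fin (suc m) → Fin (suc m)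
cyclicPred {m} Fin.zero = fromℕ m
cyclicPred (Fin.suc i) = inject₁ i

cyclicPred-injective : ∀ {m} → Injective _≡_ _≡_ (cyclicPred {m})
cyclicPred-injective {x = Fin.zero}  {Fin.zero}  _ = ≡.refl
cyclicPred-injective {x = Fin.zero}  {Fin.suc _} e = contradiction e Finₚ.fromℕ≢inject₁
cyclicPred-injective {x = Fin.suc _} {Fin.zero}  e = contradiction (≡.sym e) Finₚ.fromℕ≢inject₁
cyclicPred-injective {x = Fin.suc _} {Fin.suc _} e = ≡.cong Fin.suc (Finₚ.inject₁-injective e)

-- Copies X^{(k)} and the exponents of ω in X^ω are numbered from 1.
label : ∀ {n} → Fin n → ℕ
label k = suc (toℕ k)

label-injective : ∀ {n} → Injective _≡_ _≡_ (label {n})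
label-injective = Finₚ.toℕ-injective ∘ ℕₚ.suc-injective

shiftOn : ∀ {r m} → Subset r → (Fin r → Fin (suc m)) → Fin r → Fin (suc m)
shiftOn I κ j = (if lookup I j then cyclicPred else id) (κ j)

lookup-∁ : ∀ {r} {I : Subset r} {j} → j ∈ ∁ I → lookup I j ≡ outside
lookup-∁ {I = I} {j} j∈∁I =
  not-injective (≡.trans (≡.sym (lookup-map j not I)) ([]=⇒lookup j∈∁I))

SameKernelOn-injective : ∀ {r n} {S : Subset r} {κ κ′ : Fin r → Fin n}
  (σ : Fin n → Fin n) → Injective _≡_ _≡_ σ → (∀ j → j ∈ S → κ′ j ≡ σ (κ j)) →
  SameKernelOn S (label ∘ κ′) (label ∘ κ)
SameKernelOn-injective σ σ-injective κ′≡σκ j k j∈S k∈S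
  rewrite κ′≡σκ j j∈S | κ′≡σκ k k∈S =
  mk⇔ (≡.cong label ∘ σ-injective ∘ label-injective) (≡.cong (label ∘ σ) ∘ label-injective)

module _ {r m} (I : Subset r) (κ : Fin r → Fin (suc m)) where

  shiftOn-SameKernelOn : SameKernelOn I (label ∘ shiftOn I κ) (label ∘ κ)
  shiftOn-SameKernelOn = SameKernelOn-injective cyclicPred cyclicPred-injective
    (λ j j∈I → ≡.cong (λ b → (if b then cyclicPred else id) (κ j)) ([]=⇒lookup j∈I))

  shiftOn-SameKernelOn-∁ : SameKernelOn (∁ I) (label ∘ shiftOn I κ) (label ∘ κ)
  shiftOn-SameKernelOn-∁ = SameKernelOn-injective id id
    (λ j j∈∁I → ≡.cong (λ b → (if b then cyclicPred else id) (κ j)) (lookup-∁ j∈∁I))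

Nonempty⇒∣p∣>0 : ∀ {n} {p : Subset n} → Nonempty p → 0 < ∣ p ∣
Nonempty⇒∣p∣>0 {n} {p} (x , x∈p) =
  ≡.subst (_< ∣ p ∣) (∣⊥∣≡0 n) (p⊂q⇒∣p∣<∣q∣ (⊥⊆ , x , x∈p , ∉⊥))

Nonempty∁⇒∣p∣<n : ∀ {n} {p : Subset n} → Nonempty (∁ p) → ∣ p ∣ < n
Nonempty∁⇒∣p∣<n {n} {p} (x , x∈∁p) =
  ≡.subst (∣ p ∣ <_) (∣⊤∣≡n n) (p⊂q⇒∣p∣<∣q∣ (⊆⊤ , x , ∈⊤ , x∈∁p⇒x∉p x∈∁p))

module MultiSum {c ℓ} (M : Monoid c ℓ) where
  open Monoid M
  open MonoidSum M using (sum; sum-cong-≋)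
  open SetoidReasoning setoid

  ∑ᵐ : ∀ {r n} → ((Fin r → Fin n) → Carrier) → Carrier
  ∑ᵐ {zero}  F = F (λ ())
  ∑ᵐ {suc r} F = sum (λ k → ∑ᵐ (λ κ → F (k ◂ κ)))

  ∑ᵐ-cong : ∀ {r n} {F G : (Fin r → Fin n) → Carrier} → (∀ κ → F κ ≈ G κ) → ∑ᵐ F ≈ ∑ᵐ G
  ∑ᵐ-cong {zero}  F≈G = F≈G _
  ∑ᵐ-cong {suc r} {n} F≈G = sum-cong-≋ {n} (λ k → ∑ᵐ-cong (λ κ → F≈G (k ◂ κ)))

  SumInvariant : ∀ {n} → (Fin n → Fin n) → Set (c ⊔ ℓ)
  SumInvariant σ = ∀ f → sum f ≈ sum (f ∘ σ)

  ∑ᵐ-reindex : ∀ {r n} (σ : Fin r → Fin n → Fin n) → (∀ j → SumInvariant (σ j)) →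
    ∀ {F} → F Preserves _≗_ ⟶ _≈_ → ∑ᵐ F ≈ ∑ᵐ (λ κ → F (λ j → σ j (κ j)))
  ∑ᵐ-reindex {zero}  σ σ-invariant F-cong = F-cong (λ ())
  ∑ᵐ-reindex {suc r} {n} σ σ-invariant {F} F-cong = begin
      sum (λ k → ∑ᵐ (λ κ → F (k ◂ κ)))
    ≈⟨ sum-cong-≋ {n} (λ k → ∑ᵐ-reindex (σ ∘ Fin.suc) (σ-invariant ∘ Fin.suc)
                                      (F-cong ∘ ∷-cong ≡.refl)) ⟩
      sum (λ k → ∑ᵐ (λ κ → F (k ◂ σ′ κ)))
    ≈⟨ σ-invariant Fin.zero _ ⟩
      sum (λ k → ∑ᵐ (λ κ → F (σ Fin.zero k ◂ σ′ κ)))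
    ≈⟨ sum-cong-≋ {n} (λ k → ∑ᵐ-cong {r} (λ κ → F-cong (∷-cong ≡.refl (λ _ → ≡.refl)))) ⟩
      sum (λ k → ∑ᵐ (λ κ → F (λ j → σ j ((k ◂ κ) j))))
    ∎
    where σ′ = λ κ j → σ (Fin.suc j) (κ j)

module _ {c ℓ} (M : CommutativeMonoid c ℓ) where
  open CommutativeMonoid M
  open MonoidSum monoid using (sum-init-last)
  open MultiSum monoid using (SumInvariant)

  cyclicPred-SumInvariant : ∀ {m} → SumInvariant (cyclicPred {m})
  cyclicPred-SumInvariant f = trans (sum-init-last f) (comm _ _)

module FiniteSums {c ℓ} (R : Semiring c ℓ) where
  open Semiring R
  open SemiringSum R public
    using (*-distribˡ-sum; *-distribʳ-sum)
    renaming (sum to ∑; sum-cong-≋ to ∑-cong)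
  open MonoidSum *-monoid public
    using () renaming (sum to ∏; sum-cong-≋ to ∏-cong)
  open MultiSum +-monoid public
  open SetoidReasoning setoid

  *-distribˡ-∑ᵐ : ∀ {r n} a (F : (Fin r → Fin n) → Carrier) → a * ∑ᵐ F ≈ ∑ᵐ (λ κ → a * F κ)
  *-distribˡ-∑ᵐ {zero}  a F = refl
  *-distribˡ-∑ᵐ {suc r} {n} a F =
    trans (*-distribˡ-sum a (λ k → ∑ᵐ (λ κ → F (k ◂ κ))))
          (∑-cong {n} (λ k → *-distribˡ-∑ᵐ a (λ κ → F (k ◂ κ))))

  ∏∑-expand : ∀ {r n} (f : Fin r → Fin n → Carrier) →
    ∏ (λ j → ∑ (f j)) ≈ ∑ᵐ (λ κ → ∏ (λ j → f j (κ j)))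
  ∏∑-expand {zero}  f = refl
  ∏∑-expand {suc r} {n} f = begin
      ∑ (f Fin.zero) * ∏ (λ j → ∑ (f (Fin.suc j)))
    ≈⟨ *-congˡ (∏∑-expand (f ∘ Fin.suc)) ⟩
      ∑ (f Fin.zero) * ∑ᵐ tail
    ≈⟨ *-distribʳ-sum _ (f Fin.zero) ⟩
      ∑ (λ k → f Fin.zero k * ∑ᵐ tail)
    ≈⟨ ∑-cong {n} (λ k → *-distribˡ-∑ᵐ (f Fin.zero k) tail) ⟩
      ∑ᵐ (λ κ → ∏ (λ j → f j (κ j)))
    ∎
    where tail = λ κ → ∏ (λ j → f (Fin.suc j) (κ j))

module Scalars (K : CharZeroField) where
  open CharZeroField K public
  open FiniteSums semiring public
  open CommutativeMonoidSum *-commutativeMonoid using () renaming (∑-distrib-+ to ∏-distrib-*)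
  open RingProperties (CommutativeRing.ring scalarRing)
    using ([y-z]x≈yx-zx; x≈y⇒x∙y⁻¹≈ε; x∙y⁻¹≈ε⇒x≈y)
  open SetoidReasoning setoid

  weight : ∀ {r n} → Carrier → (Fin r → Fin n) → Carrier
  weight ω κ = ∏ (λ j → pow ω (label (κ j)))

  pow-label-cyclicPred : ∀ {m ω} → pow ω (suc m) ≈ 1# →
    ∀ k → pow ω (label k) ≈ ω * pow ω (label (cyclicPred {m} k))
  pow-label-cyclicPred {m} {ω} ωⁿ≈1 Fin.zero =
    *-congˡ (sym (trans (reflexive (≡.cong (pow ω ∘ suc) (Finₚ.toℕ-fromℕ m))) ωⁿ≈1))
  pow-label-cyclicPred {ω = ω} _ (Fin.suc i) =
    *-congˡ (reflexive (≡.cong (pow ω ∘ suc) (≡.sym (Finₚ.toℕ-inject₁ i))))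

  ∏-indicator : ∀ {r} (p : Subset r) x → ∏ (λ j → if lookup p j then x else 1#) ≈ pow x ∣ p ∣
  ∏-indicator []            x = refl
  ∏-indicator (inside ∷ p)  x = *-congˡ (∏-indicator p x)
  ∏-indicator (outside ∷ p) x = trans (*-identityˡ _) (∏-indicator p x)

  weight-shiftOn : ∀ {r m ω} → pow ω (suc m) ≈ 1# → (I : Subset r) (κ : Fin r → Fin (suc m)) →
    weight ω κ ≈ pow ω ∣ I ∣ * weight ω (shiftOn I κ)
  weight-shiftOn {ω = ω} ωⁿ≈1 I κ = begin
      weight ω κ
    ≈⟨ ∏-cong (λ j → factor (lookup I j) (κ j)) ⟩
      ∏ (λ j → (if lookup I j then ω else 1#) * pow ω (label (shiftOn I κ j)))
    ≈⟨ ∏-distrib-* (λ j → if lookup I j then ω else 1#) (λ j → pow ω (label (shiftOn I κ j))) ⟩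
      ∏ (λ j → if lookup I j then ω else 1#) * weight ω (shiftOn I κ)
    ≈⟨ *-congʳ (∏-indicator I ω) ⟩
      pow ω ∣ I ∣ * weight ω (shiftOn I κ)
    ∎
    where
    factor : ∀ b k → pow ω (label k) ≈ (if b then ω else 1#) * pow ω (label ((if b then cyclicPred else id) k))
    factor true  = pow-label-cyclicPred ωⁿ≈1
    factor false _ = sym (*-identityˡ _)

  x*y≈0⇒y≈0 : ∀ {x y} → ¬ x ≈ 0# → x * y ≈ 0# → y ≈ 0#
  x*y≈0⇒y≈0 {x} {y} x≉0 xy≈0 = begin
      y                  ≈⟨ *-identityˡ y ⟨
      1# * y             ≈⟨ *-congʳ (trans (*-comm _ _) (⁻¹-inverse x x≉0)) ⟨
      (x⁻¹ * x) * y      ≈⟨ *-assoc x⁻¹ x y ⟩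
      x⁻¹ * (x * y)      ≈⟨ *-congˡ xy≈0 ⟩
      x⁻¹ * 0#           ≈⟨ zeroʳ x⁻¹ ⟩
      0#                 ∎
    where x⁻¹ = x ⁻¹[ x≉0 ]

  y≈x*y⇒y≈0 : ∀ {x y} → ¬ x ≈ 1# → y ≈ x * y → y ≈ 0#
  y≈x*y⇒y≈0 {x} {y} x≉1 y≈xy = x*y≈0⇒y≈0 (x≉1 ∘ x∙y⁻¹≈ε⇒x≈y x 1#) (begin
      (x - 1#) * y       ≈⟨ [y-z]x≈yx-zx y x 1# ⟩
      x * y - 1# * y     ≈⟨ x≈y⇒x∙y⁻¹≈ε (trans (sym y≈xy) (sym (*-identityˡ y))) ⟩
      0#                 ∎)

module AlgebraSums {K : CharZeroField} (A : UnitalAlgebra K) where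
  open UnitalAlgebra A hiding (module K)
  open FiniteSums semiring public
  module K = Scalars K
  open SetoidReasoning setoid

  sum≡∑ : ∀ {r} (f : Fin r → Carrier) → sum f ≡ ∑ f
  sum≡∑ {zero}  f = ≡.refl
  sum≡∑ {suc r} f = ≡.cong (f Fin.zero +_) (sum≡∑ (f ∘ Fin.suc))

  prod≡∏ : ∀ {r} (f : Fin r → Carrier) → prod f ≡ ∏ f
  prod≡∏ {zero}  f = ≡.refl
  prod≡∏ {suc r} f = ≡.cong (f Fin.zero *_) (prod≡∏ (f ∘ Fin.suc))

  prod-cong : ∀ {r} {f g : Fin r → Carrier} → (∀ j → f j ≈ g j) → prod f ≈ prod g
  prod-cong {f = f} {g} f≈g =
    trans (reflexive (prod≡∏ f)) (trans (∏-cong f≈g) (reflexive (≡.sym (prod≡∏ g))))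

  ∏-· : ∀ {r} (c : Fin r → CharZeroField.Carrier K) (Y : Fin r → Carrier) →
    ∏ (λ j → c j · Y j) ≈ K.∏ c · ∏ Y
  ∏-· {zero}  c Y = sym (·-identity 1#)
  ∏-· {suc r} c Y = begin
      (c₀ · Y₀) * ∏ (λ j → c (Fin.suc j) · Y (Fin.suc j))
    ≈⟨ *-congˡ (∏-· (c ∘ Fin.suc) (Y ∘ Fin.suc)) ⟩
      (c₀ · Y₀) * (c′ · Y′)
    ≈⟨ ·-*-assocˡ c₀ Y₀ (c′ · Y′) ⟩
      c₀ · (Y₀ * (c′ · Y′))
    ≈⟨ ·-cong K.refl (·-*-assocʳ c′ Y₀ Y′) ⟩
      c₀ · (c′ · (Y₀ * Y′))
    ≈⟨ ·-assoc c₀ c′ (Y₀ * Y′) ⟨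
      (c₀ K.* c′) · (Y₀ * Y′)
    ∎
    where
    c₀ = c Fin.zero
    Y₀ = Y Fin.zero
    c′ = K.∏ (c ∘ Fin.suc)
    Y′ = ∏ (Y ∘ Fin.suc)

module StateSums {K : CharZeroField} (P : NCProbabilitySpace K) where
  open NCProbabilitySpace P hiding (module K)
  open AlgebraSums alg
  open RingProperties (CommutativeRing.ring K.scalarRing) using (x+x≈x⇒x≈0)

  φ-0# : φ 0# K.≈ K.0#
  φ-0# = x+x≈x⇒x≈0 (φ 0#) (K.trans (K.sym (φ-+ 0# 0#)) (φ-cong (+-identityʳ 0#)))

  φ-∑ : ∀ {r} (f : Fin r → Carrier) → φ (∑ f) K.≈ K.∑ (φ ∘ f)
  φ-∑ {zero}  f = φ-0#
  φ-∑ {suc r} f = K.trans (φ-+ _ _) (K.+-congˡ (φ-∑ (f ∘ Fin.suc)))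

  φ-∑ᵐ : ∀ {r n} (F : (Fin r → Fin n) → Carrier) → φ (∑ᵐ F) K.≈ K.∑ᵐ (φ ∘ F)
  φ-∑ᵐ {zero}      F = K.refl
  φ-∑ᵐ {suc r} {n} F =
    K.trans (φ-∑ (λ k → ∑ᵐ (λ κ → F (k ◂ κ)))) (K.∑-cong {n} (λ k → φ-∑ᵐ (λ κ → F (k ◂ κ))))

  φ-prod-sum-expand : ∀ {r n} (c : Fin r → Fin n → K.Carrier) (Y : Fin r → Fin n → Carrier) →
    φ (prod (λ j → sum (λ k → c j k · Y j k)))
      K.≈ K.∑ᵐ (λ κ → K.∏ (λ j → c j (κ j)) K.* φ (prod (λ j → Y j (κ j))))
  φ-prod-sum-expand {r} {n} c Y = begin
      φ (prod (λ j → sum (f j)))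
    ≈⟨ φ-cong (trans (reflexive (prod≡∏ (λ j → sum (f j))))
                     (∏-cong {r} (λ j → reflexive (sum≡∑ (f j))))) ⟩
      φ (∏ (λ j → ∑ (f j)))
    ≈⟨ φ-cong (∏∑-expand f) ⟩
      φ (∑ᵐ (λ κ → ∏ (λ j → f j (κ j))))
    ≈⟨ φ-∑ᵐ (λ κ → ∏ (λ j → f j (κ j))) ⟩
      K.∑ᵐ (λ κ → φ (∏ (λ j → f j (κ j))))
    ≈⟨ K.∑ᵐ-cong {r} {n} term ⟩
      K.∑ᵐ (λ κ → K.∏ (λ j → c j (κ j)) K.* φ (prod (λ j → Y j (κ j))))
    ∎
    where
    open SetoidReasoning K.setoid
    f = λ j k → c j k · Y j k
    term : ∀ κ → φ (∏ (λ j → f j (κ j))) K.≈ K.∏ (λ j → c j (κ j)) K.* φ (prod (λ j → Y j (κ j)))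
    term κ = K.trans (φ-cong (∏-· (λ j → c j (κ j)) (λ j → Y j (κ j))))
               (K.trans (φ-· _ _) (K.*-congˡ (φ-cong (reflexive (≡.sym (prod≡∏ (λ j → Y j (κ j))))))))

module _ {K : CharZeroField} {𝒜 : NCProbabilitySpace K} (ℰ : ExchangeabilitySystem 𝒜) where
  private
    module K = Scalars K
    module 𝒜 = NCProbabilitySpace 𝒜
  open ExchangeabilitySystem ℰ using (module 𝒰; copy; mixedMoment)
  open StateSums (ExchangeabilitySystem.𝒰 ℰ) using (φ-prod-sum-expand)

  weightedMomentSum : ∀ {r} m → K.Carrier → (Fin r → 𝒜.Carrier) → K.Carrier
  weightedMomentSum m ω X =
    K.∑ᵐ {n = suc m} (λ κ → K.weight ω κ K.* mixedMoment X (label ∘ κ))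

  ωCopy-moment-expand : ∀ {r} m ω (X : Fin r → 𝒜.Carrier) →
    𝒰.φ (𝒰.prod (λ j → ωCopy ℰ (suc m) ω (X j))) K.≈ weightedMomentSum m ω X
  ωCopy-moment-expand m ω X =
    φ-prod-sum-expand (λ _ k → K.pow ω (label k)) (λ j k → copy (label k) (X j))

  mixedMoment-cong : ∀ {r} (X : Fin r → 𝒜.Carrier) {i i′ : Fin r → ℕ} →
    i ≗ i′ → mixedMoment X i K.≈ mixedMoment X i′
  mixedMoment-cong X i≗i′ =
    𝒰.φ-cong (AlgebraSums.prod-cong 𝒰.alg (λ j → 𝒰.reflexive (≡.cong (λ k → copy k (X j)) (i≗i′ j))))

  mixedMoment-shiftOn : ∀ {r m} {X : Fin r → 𝒜.Carrier} {I : Subset r} → IndependentFamilies ℰ X I →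
    (κ : Fin r → Fin (suc m)) → mixedMoment X (label ∘ shiftOn I κ) K.≈ mixedMoment X (label ∘ κ)
  mixedMoment-shiftOn {r} {X = X} {I} independent κ =
    independent r X I (λ j j∈I → 𝒜.gen (j , j∈I)) (λ j j∉I → 𝒜.gen (j , j∉I)) _ _
      (shiftOn-SameKernelOn I κ) (shiftOn-SameKernelOn-∁ I κ)

  weightedMomentSum-shift : ∀ {r m ω} {X : Fin r → 𝒜.Carrier} {I : Subset r} →
    K.pow ω (suc m) K.≈ K.1# → IndependentFamilies ℰ X I →
    weightedMomentSum m ω X K.≈ K.pow ω ∣ I ∣ K.* weightedMomentSum m ω X
  weightedMomentSum-shift {r} {m} {ω} {X} {I} ωⁿ≈1 independent = begin
      K.∑ᵐ term
    ≈⟨ K.∑ᵐ-cong term-shift ⟩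
      K.∑ᵐ (λ κ → K.pow ω ∣ I ∣ K.* term (shiftOn I κ))
    ≈⟨ K.*-distribˡ-∑ᵐ (K.pow ω ∣ I ∣) (term ∘ shiftOn I) ⟨
      K.pow ω ∣ I ∣ K.* K.∑ᵐ (term ∘ shiftOn I)
    ≈⟨ K.*-congˡ (K.∑ᵐ-reindex σ (σ-invariant ∘ lookup I) term-cong) ⟨
      K.pow ω ∣ I ∣ K.* K.∑ᵐ term
    ∎
    where
    open SetoidReasoning K.setoid
    term : (Fin r → Fin (suc m)) → K.Carrier
    term κ = K.weight ω κ K.* mixedMoment X (label ∘ κ)

    term-shift : ∀ κ → term κ K.≈ K.pow ω ∣ I ∣ K.* term (shiftOn I κ)
    term-shift κ = K.trans (K.*-cong (K.weight-shiftOn ωⁿ≈1 I κ) (K.sym (mixedMoment-shiftOn independent κ)))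
                           (K.*-assoc _ _ _)

    term-cong : term Preserves _≗_ ⟶ K._≈_
    term-cong κ≗κ′ = K.*-cong (K.∏-cong (λ j → K.reflexive (≡.cong (K.pow ω ∘ label) (κ≗κ′ j))))
                              (mixedMoment-cong X (≡.cong label ∘ κ≗κ′))

    σ : Fin r → Fin (suc m) → Fin (suc m)
    σ j = if lookup I j then cyclicPred else id

    σ-invariant : ∀ b → K.SumInvariant (if b then cyclicPred else id)
    σ-invariant true  = cyclicPred-SumInvariant K.+-commutativeMonoid
    σ-invariant false _ = K.refl

proposition2p2 : {K : CharZeroField} {𝒜 : NCProbabilitySpace K}
    (ℰ : ExchangeabilitySystem 𝒜) (m : ℕ)
    (X : Fin (suc m) → NCProbabilitySpace.Carrier 𝒜) (I : Subset (suc m)) →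
    Nonempty I → Nonempty (∁ I) → IndependentFamilies ℰ X I →
    (ω : CharZeroField.Carrier K) → CharZeroField.PrimitiveRoot K (suc m) ω →
    CharZeroField._≈_ K (cumulant ℰ m ω X) (CharZeroField.0# K)
proposition2p2 {K} ℰ m X I I≢∅ ∁I≢∅ independent ω (ωⁿ≈1 , ω-primitive) =
  K.trans (K.*-congˡ (K.trans (ωCopy-moment-expand ℰ m ω X) moments≈0)) (K.zeroʳ _)
  where
  module K = Scalars K
  ω^∣I∣≉1 : ¬ K.pow ω ∣ I ∣ K.≈ K.1#
  ω^∣I∣≉1 = ω-primitive ∣ I ∣ (Nonempty⇒∣p∣>0 I≢∅) (Nonempty∁⇒∣p∣<n ∁I≢∅)
  moments≈0 : weightedMomentSum ℰ m ω X K.≈ K.0#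
  moments≈0 = K.y≈x*y⇒y≈0 ω^∣I∣≉1 (weightedMomentSum-shift ℰ ωⁿ≈1 independent)
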